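{- For every partial computable function $\psi:\omega\to\{0,1\}$, the group $\mathcal H/\mathcal R$ (defined from $\psi$ as in the context) is a torsion-free abelian group.
   Context: Let $(p_i)_{i\in\omega}$, $(q_i)_{i\in\omega}$, $(r_i)_{i\in\omega}$ be three sequences of primes which together partition the set of odd primes. Let $\psi$ be a partial computable function with values in $\{0,1\}$; write $\psi_{\text{at } t}(i)=e$ to mean that the computation of $\psi(i)$ converges exactly at stage $t$ (and not before) with value $e$. Let $\mathcal H$ be the free abelian group, written additively, on generators $\alpha_i,\beta_i,\gamma_i$ ($i\in\omega$). Let $\mathcal R$ be the set of relations $\{\mathcal R_{i,t}:\psi(i)\text{ converges exactly at stage }t\}$, where $\mathcal R_{i,t}$ is $p_i^t\alpha_i=q_i^t\beta_i$ if $\psi_{\text{at }t}(i)=0$ and $p_i^t\alpha_i=-q_i^t\beta_i$ if $\psi_{\text{at }t}(i)=1$; $\mathcal H/\mathcal R$ is the quotient of $\mathcal H$ by the subgroup generated by these relations. -}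

module Defs where

open import Data.Nat as ℕ using (ℕ; zero; suc; _<_; _^_)
open import Data.Nat.Primality using (Prime)
open import Data.Nat.Divisibility using (_∣_)
open import Data.Integer as ℤ using (ℤ; +_; -_; _*_; _+_)
open import Data.Bool using (Bool; true; false)
open import Data.Maybe using (Maybe; just; nothing)
open import Data.List using (List; []; _∷_; map)
open import Data.Product using (Σ; _×_; _,_; ∃; ∃-syntax)
open import Data.Sum using (_⊎_)
open import Relation.Nullary using (¬_; yes; no)
open import Relation.Binary.PropositionalEquality using (_≡_; _≢_)

-- Partial computable functions ω → {0,1}, given by their stage-wise
-- approximation: ψ i t = just e means "by stage t the computation of
-- ψ(i) has halted with output e" (false = 0, true = 1).
-- Every Agda function ℕ → ℕ → Maybe Bool is computable, and every partial
-- computable function has such a stage approximation.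

StageFun : Set
StageFun = ℕ → ℕ → Maybe Bool

ConvergesAt : StageFun → ℕ → ℕ → Bool → Set
ConvergesAt ψ i t e = (ψ i t ≡ just e) × (∀ s → s < t → ψ i s ≡ nothing)

OddPrime : ℕ → Set
OddPrime n = Prime n × ¬ (2 ∣ n)

record PrimePartition (p q r : ℕ → ℕ) : Set where
  field
    p-oddPrime : ∀ i → OddPrime (p i)
    q-oddPrime : ∀ i → OddPrime (q i)
    r-oddPrime : ∀ i → OddPrime (r i)
    p-injective : ∀ i j → p i ≡ p j → i ≡ j
    q-injective : ∀ i j → q i ≡ q j → i ≡ j
    r-injective : ∀ i j → r i ≡ r j → i ≡ j
    p≢q : ∀ i j → p i ≢ q j
    p≢r : ∀ i j → p i ≢ r j
    q≢r : ∀ i j → q i ≢ r j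
    covers : ∀ n → OddPrime n →
             (∃[ i ] p i ≡ n) ⊎ ((∃[ i ] q i ≡ n) ⊎ (∃[ i ] r i ≡ n))

data Gen : Set where
  α β γ : ℕ → Gen

δ : Gen → Gen → ℤ
δ (α i) (α j) with i ℕ.≟ j
... | yes _ = + 1
... | no _ = + 0
δ (β i) (β j) with i ℕ.≟ j
... | yes _ = + 1
... | no _ = + 0
δ (γ i) (γ j) with i ℕ.≟ j
... | yes _ = + 1
... | no _ = + 0
δ _ _ = + 0

-- An element of ℋ is presented as a formal ℤ-linear combination of
-- generators; two presentations denote the same element iff they have
-- the same coefficient function.
ℋ : Set
ℋ = List (ℤ × Gen)

coeff : ℋ → Gen → ℤ
coeff [] g = + 0
coeff ((c , h) ∷ xs) g = c * δ h g + coeff xs g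

scale : ℤ → ℋ → ℋ
scale n = map (λ { (c , h) → (n * c , h) })

-- The relations ℛ.  ℛ_{i,t} is p_i^t α_i = q_i^t β_i (value 0) or
-- p_i^t α_i = - q_i^t β_i (value 1); as an element of ℋ it is
-- p_i^t α_i - q_i^t β_i, resp. p_i^t α_i + q_i^t β_i.

relElem : (p q : ℕ → ℕ) → ℕ → ℕ → Bool → ℋ
relElem p q i t false = (+ (p i ^ t) , α i) ∷ (- (+ (q i ^ t)) , β i) ∷ []
relElem p q i t true  = (+ (p i ^ t) , α i) ∷ (+ (q i ^ t) , β i) ∷ []

RelIndex : StageFun → Set
RelIndex ψ = Σ ℕ λ i → Σ ℕ λ t → Σ Bool λ e → ConvergesAt ψ i t e

relOf : (p q : ℕ → ℕ) (ψ : StageFun) → RelIndex ψ → ℋ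
relOf p q ψ (i , t , e , _) = relElem p q i t e

combCoeff : (p q : ℕ → ℕ) (ψ : StageFun) → List (ℤ × RelIndex ψ) → Gen → ℤ
combCoeff p q ψ [] g = + 0
combCoeff p q ψ ((c , ρ) ∷ cs) g = c * coeff (relOf p q ψ ρ) g + combCoeff p q ψ cs g

In⟨ℛ⟩ : (p q : ℕ → ℕ) (ψ : StageFun) → ℋ → Set
In⟨ℛ⟩ p q ψ x = Σ (List (ℤ × RelIndex ψ)) λ cs → ∀ g → coeff x g ≡ combCoeff p q ψ cs g

-- ℋ/ℛ is torsion-free: n·[x] = 0 with n ≠ 0 implies [x] = 0
-- (ℋ/ℛ is abelian automatically, being a quotient of an abelian group)
QuotientTorsionFree : (p q : ℕ → ℕ) (ψ : StageFun) → Set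
QuotientTorsionFree p q ψ =
  ∀ (n : ℤ) (x : ℋ) → n ≢ + 0 → In⟨ℛ⟩ p q ψ (scale n x) → In⟨ℛ⟩ p q ψ x

module Submission where

-- Every relation with index i is p_i^t α_i ± q_i^t β_i, and since ψ(i)
-- converges at most once, all relations with index i are the same element.
-- Hence any combination of relations can be normalised so that each index
-- occurs at most once.  In a normalised combination Σ c_ρ ρ the coefficient
-- of α_i (resp. β_i) is c·p_i^t (resp. ±c·q_i^t), where c is the coefficient
-- of the unique relation of index i.  If n divides every coefficient of the
-- combination, then n ∣ c·p_i^t and n ∣ c·q_i^t, so n ∣ c because p_i^t and
-- q_i^t are coprime.  Therefore a normalised combination all of whose
-- coefficients are divisible by n is n times another combination; applying
-- this to n·x and cancelling n gives x ∈ ⟨ℛ⟩.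

open import Defs
open import Data.Nat as ℕ using (ℕ; zero; suc; _^_)
import Data.Nat.Properties as ℕ
open import Data.Nat.Primality using (Prime; prime⇒irreducible; ¬prime[1])
import Data.Nat.Divisibility as ℕ
open import Data.Nat.Coprimality as Coprimality
  using (Coprime; coprime-divisor; coprime-factors; 1-coprimeTo)
open import Data.Integer as ℤ using (ℤ; +_; -_; _*_; _+_; ∣_∣)
import Data.Integer.Properties as ℤ
open import Data.Integer.Divisibility.Signed
  using (_∣_; divides; ∣⇒∣ᵤ; ∣ᵤ⇒∣; ∣m+n∣m⇒∣n; ∣m⇒∣m*n)
open import Data.Integer.Tactic.RingSolver using (solve-∀)
open import Data.Bool using (Bool; true; false)
open import Data.Maybe.Properties using (just-injective)
open import Data.List using (List; []; _∷_)
open import Data.List.Relation.Unary.All using (All; []; _∷_)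
open import Data.List.Relation.Unary.AllPairs using (AllPairs; []; _∷_)
open import Data.Product using (Σ; _×_; _,_; proj₁; proj₂)
open import Data.Sum using (inj₁; inj₂)
open import Data.Empty using (⊥-elim)
open import Relation.Nullary using (yes; no; contradiction)
open import Relation.Binary using (tri<; tri≈; tri>)
open import Relation.Binary.PropositionalEquality
open ≡-Reasoning

coprime-*ʳ : ∀ {a m k} → Coprime a m → Coprime a k → Coprime a (m ℕ.* k)
coprime-*ʳ {a} {m} a⊥m a⊥k {d} (d∣a , d∣mk) =
  a⊥k (d∣a , coprime-divisor d⊥m d∣mk)
  where
  d⊥m : Coprime d m
  d⊥m (e∣d , e∣m) = a⊥m (ℕ.∣-trans e∣d d∣a , e∣m)

coprime-^ʳ : ∀ {a b} → Coprime a b → ∀ t → Coprime a (b ^ t)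
coprime-^ʳ {a} a⊥b zero    = Coprimality.sym (1-coprimeTo a)
coprime-^ʳ     a⊥b (suc t) = coprime-*ʳ a⊥b (coprime-^ʳ a⊥b t)

coprime-^ : ∀ {a b} → Coprime a b → ∀ s t → Coprime (a ^ s) (b ^ t)
coprime-^ a⊥b s t =
  Coprimality.sym (coprime-^ʳ (Coprimality.sym (coprime-^ʳ a⊥b t)) s)

distinct-primes-coprime : ∀ {a b} → Prime a → Prime b → a ≢ b → Coprime a b
distinct-primes-coprime pa pb a≢b (d∣a , d∣b) with prime⇒irreducible pa d∣a
... | inj₁ d≡1 = d≡1
... | inj₂ refl with prime⇒irreducible pb d∣b
...   | inj₁ refl = ⊥-elim (¬prime[1] pa)
...   | inj₂ a≡b  = ⊥-elim (a≢b a≡b)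

coprime-cofactor : ∀ {n c P S} → Coprime ∣ P ∣ ∣ S ∣ →
                   n ∣ c * P → n ∣ c * S → n ∣ c
coprime-cofactor {n} {c} {P} {S} P⊥S n∣cP n∣cS =
  ∣ᵤ⇒∣ (coprime-factors P⊥S (unsigned n∣cP , unsigned n∣cS))
  where
  unsigned : ∀ {X} → n ∣ c * X → ∣ n ∣ ℕ.∣ ∣ X ∣ ℕ.* ∣ c ∣
  unsigned {X} n∣cX =
    subst (∣ n ∣ ℕ.∣_) (trans (ℤ.abs-* c X) (ℕ.*-comm ∣ c ∣ ∣ X ∣)) (∣⇒∣ᵤ n∣cX)

genIndex : Gen → ℕ
genIndex (α i) = i
genIndex (β i) = i
genIndex (γ i) = i

δ-refl : ∀ g → δ g g ≡ + 1
δ-refl (α i) with i ℕ.≟ i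
... | yes _  = refl
... | no i≢i = contradiction refl i≢i
δ-refl (β i) with i ℕ.≟ i
... | yes _  = refl
... | no i≢i = contradiction refl i≢i
δ-refl (γ i) with i ℕ.≟ i
... | yes _  = refl
... | no i≢i = contradiction refl i≢i

δ-apart : ∀ g h → genIndex g ≢ genIndex h → δ g h ≡ + 0
δ-apart (α i) (α j) i≢j with i ℕ.≟ j
... | yes i≡j = contradiction i≡j i≢j
... | no _    = refl
δ-apart (β i) (β j) i≢j with i ℕ.≟ j
... | yes i≡j = contradiction i≡j i≢j
... | no _    = refl
δ-apart (γ i) (γ j) i≢j with i ℕ.≟ j
... | yes i≡j = contradiction i≡j i≢j
... | no _    = refl
δ-apart (α _) (β _) _ = refl
δ-apart (α _) (γ _) _ = refl
δ-apart (β _) (α _) _ = refl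
δ-apart (β _) (γ _) _ = refl
δ-apart (γ _) (α _) _ = refl
δ-apart (γ _) (β _) _ = refl

coeff-scale : ∀ n x g → coeff (scale n x) g ≡ n * coeff x g
coeff-scale n []             g = sym (ℤ.*-zeroʳ n)
coeff-scale n ((c , h) ∷ xs) g = begin
  n * c * δ h g + coeff (scale n xs) g ≡⟨ cong (λ y → n * c * δ h g + y) (coeff-scale n xs g) ⟩
  n * c * δ h g + n * coeff xs g       ≡⟨ distrib n c (δ h g) (coeff xs g) ⟩
  n * (c * δ h g + coeff xs g)         ∎
  where
  distrib : ∀ n c d y → n * c * d + n * y ≡ n * (c * d + y)
  distrib = solve-∀

coeff-pair : ∀ a g b h k → coeff ((a , g) ∷ (b , h) ∷ []) k ≡ a * δ g k + b * δ h k
coeff-pair a g b h k = cong (λ y → a * δ g k + y) (ℤ.+-identityʳ (b * δ h k))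

signed : Bool → ℤ → ℤ
signed false x = - x
signed true  x = x

∣signed∣ : ∀ e x → ∣ signed e x ∣ ≡ ∣ x ∣
∣signed∣ false x = ℤ.∣-i∣≡∣i∣ x
∣signed∣ true  x = refl

module Relations (p q : ℕ → ℕ) where

  pCoeff : ℕ → ℕ → ℤ
  pCoeff i t = + (p i ^ t)

  qCoeff : ℕ → ℕ → Bool → ℤ
  qCoeff i t e = signed e (+ (q i ^ t))

  relElem-coeff : ∀ i t e g → coeff (relElem p q i t e) g ≡
                  pCoeff i t * δ (α i) g + qCoeff i t e * δ (β i) g
  relElem-coeff i t false g = coeff-pair (pCoeff i t) (α i) (qCoeff i t false) (β i) g
  relElem-coeff i t true  g = coeff-pair (pCoeff i t) (α i) (qCoeff i t true) (β i) g

  relElem-α : ∀ i t e → coeff (relElem p q i t e) (α i) ≡ pCoeff i t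
  relElem-α i t e = begin
    coeff (relElem p q i t e) (α i)                      ≡⟨ relElem-coeff i t e (α i) ⟩
    pCoeff i t * δ (α i) (α i) + qCoeff i t e * + 0      ≡⟨ cong (λ d → pCoeff i t * d + qCoeff i t e * + 0) (δ-refl (α i)) ⟩
    pCoeff i t * + 1 + qCoeff i t e * + 0                ≡⟨ first-term (pCoeff i t) (qCoeff i t e) ⟩
    pCoeff i t                                           ∎
    where
    first-term : ∀ a b → a * + 1 + b * + 0 ≡ a
    first-term = solve-∀

  relElem-β : ∀ i t e → coeff (relElem p q i t e) (β i) ≡ qCoeff i t e
  relElem-β i t e = begin
    coeff (relElem p q i t e) (β i)                      ≡⟨ relElem-coeff i t e (β i) ⟩
    pCoeff i t * + 0 + qCoeff i t e * δ (β i) (β i)      ≡⟨ cong (λ d → pCoeff i t * + 0 + qCoeff i t e * d) (δ-refl (β i)) ⟩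
    pCoeff i t * + 0 + qCoeff i t e * + 1                ≡⟨ second-term (pCoeff i t) (qCoeff i t e) ⟩
    qCoeff i t e                                         ∎
    where
    second-term : ∀ a b → a * + 0 + b * + 1 ≡ b
    second-term = solve-∀

  relElem-apart : ∀ i t e g → genIndex g ≢ i → coeff (relElem p q i t e) g ≡ + 0
  relElem-apart i t e g g≢i = begin
    coeff (relElem p q i t e) g                          ≡⟨ relElem-coeff i t e g ⟩
    pCoeff i t * δ (α i) g + qCoeff i t e * δ (β i) g    ≡⟨ cong₂ (λ a b → pCoeff i t * a + qCoeff i t e * b)
                                                                  (δ-apart (α i) g i≢g) (δ-apart (β i) g i≢g) ⟩
    pCoeff i t * + 0 + qCoeff i t e * + 0                ≡⟨ vanish (pCoeff i t) (qCoeff i t e) ⟩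
    + 0                                                  ∎
    where
    i≢g : i ≢ genIndex g
    i≢g i≡g = g≢i (sym i≡g)

    vanish : ∀ a b → a * + 0 + b * + 0 ≡ + 0
    vanish = solve-∀

convergence-unique : ∀ {ψ i t t′ e e′} → ConvergesAt ψ i t e → ConvergesAt ψ i t′ e′ →
                     t ≡ t′ × e ≡ e′
convergence-unique {t = t} {t′} (ψt≡e , before-t) (ψt′≡e′ , before-t′) with ℕ.<-cmp t t′
... | tri< t<t′ _ _ = contradiction (trans (sym ψt≡e) (before-t′ t t<t′)) λ ()
... | tri> _ _ t′<t = contradiction (trans (sym ψt′≡e′) (before-t t′ t′<t)) λ ()
... | tri≈ _ refl _ = refl , just-injective (trans (sym ψt≡e) ψt′≡e′)

module Combinations (p q : ℕ → ℕ) (ψ : StageFun) where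

  open Relations p q

  Comb : Set
  Comb = List (ℤ × RelIndex ψ)

  index : ℤ × RelIndex ψ → ℕ
  index (_ , i , _) = i

  R : RelIndex ψ → Gen → ℤ
  R ρ = coeff (relOf p q ψ ρ)

  CC : Comb → Gen → ℤ
  CC = combCoeff p q ψ

  relOf-index : ∀ ρ ρ′ → proj₁ ρ ≡ proj₁ ρ′ → relOf p q ψ ρ ≡ relOf p q ψ ρ′
  relOf-index (i , t , e , conv) (.i , t′ , e′ , conv′) refl
    with convergence-unique {ψ} conv conv′
  ... | refl , refl = refl

  Normal : Comb → Set
  Normal = AllPairs (λ x y → index x ≢ index y)

  insert : ℤ × RelIndex ψ → Comb → Comb
  insert x [] = x ∷ []
  insert (c , ρ) ((c′ , ρ′) ∷ xs) with proj₁ ρ ℕ.≟ proj₁ ρ′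
  ... | yes _ = (c + c′ , ρ′) ∷ xs
  ... | no _  = (c′ , ρ′) ∷ insert (c , ρ) xs

  normalise : Comb → Comb
  normalise []       = []
  normalise (x ∷ xs) = insert x (normalise xs)

  CC-insert : ∀ c ρ xs g → CC (insert (c , ρ) xs) g ≡ c * R ρ g + CC xs g
  CC-insert c ρ [] g = refl
  CC-insert c ρ ((c′ , ρ′) ∷ xs) g with proj₁ ρ ℕ.≟ proj₁ ρ′
  ... | yes same rewrite relOf-index ρ ρ′ same = merge c c′ (R ρ′ g) (CC xs g)
    where
    merge : ∀ c c′ X Y → (c + c′) * X + Y ≡ c * X + (c′ * X + Y)
    merge = solve-∀
  ... | no _ rewrite CC-insert c ρ xs g = swap (c * R ρ g) c′ (R ρ′ g) (CC xs g)
    where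
    swap : ∀ a c′ X Y → c′ * X + (a + Y) ≡ a + (c′ * X + Y)
    swap = solve-∀

  CC-normalise : ∀ xs g → CC (normalise xs) g ≡ CC xs g
  CC-normalise []             g = refl
  CC-normalise ((c , ρ) ∷ xs) g = begin
    CC (insert (c , ρ) (normalise xs)) g ≡⟨ CC-insert c ρ (normalise xs) g ⟩
    c * R ρ g + CC (normalise xs) g      ≡⟨ cong (λ y → c * R ρ g + y) (CC-normalise xs g) ⟩
    c * R ρ g + CC xs g                  ∎

  insert-fresh : ∀ {i} x xs → i ≢ index x → All (λ y → i ≢ index y) xs →
                 All (λ y → i ≢ index y) (insert x xs)
  insert-fresh x [] i≢x [] = i≢x ∷ []
  insert-fresh (c , ρ) ((c′ , ρ′) ∷ xs) i≢x (i≢x′ ∷ fresh) with proj₁ ρ ℕ.≟ proj₁ ρ′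
  ... | yes _ = i≢x′ ∷ fresh
  ... | no _  = i≢x′ ∷ insert-fresh (c , ρ) xs i≢x fresh

  insert-normal : ∀ x xs → Normal xs → Normal (insert x xs)
  insert-normal x [] [] = [] ∷ []
  insert-normal (c , ρ) ((c′ , ρ′) ∷ xs) (fresh ∷ normal) with proj₁ ρ ℕ.≟ proj₁ ρ′
  ... | yes _    = fresh ∷ normal
  ... | no ρ≢ρ′ = insert-fresh (c , ρ) xs (λ ρ′≡ρ → ρ≢ρ′ (sym ρ′≡ρ)) fresh
                  ∷ insert-normal (c , ρ) xs normal

  normalise-normal : ∀ xs → Normal (normalise xs)
  normalise-normal []       = []
  normalise-normal (x ∷ xs) = insert-normal x (normalise xs) (normalise-normal xs)

  CC-apart : ∀ g xs → All (λ y → genIndex g ≢ index y) xs → CC xs g ≡ + 0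
  CC-apart g [] [] = refl
  CC-apart g ((c , i , t , e , _) ∷ xs) (g≢i ∷ fresh) = begin
    c * coeff (relElem p q i t e) g + CC xs g ≡⟨ cong₂ (λ a b → c * a + b) (relElem-apart i t e g g≢i) (CC-apart g xs fresh) ⟩
    c * + 0 + + 0                             ≡⟨ ℤ.+-identityʳ (c * + 0) ⟩
    c * + 0                                   ≡⟨ ℤ.*-zeroʳ c ⟩
    + 0                                       ∎

  CC-head : ∀ c ρ xs g → All (λ y → genIndex g ≢ index y) xs →
            CC ((c , ρ) ∷ xs) g ≡ c * R ρ g
  CC-head c ρ xs g fresh =
    trans (cong (λ y → c * R ρ g + y) (CC-apart g xs fresh)) (ℤ.+-identityʳ (c * R ρ g))

  divide : (coprime : ∀ i t → Coprime (p i ^ t) (q i ^ t)) →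
           ∀ n xs → Normal xs → (∀ g → n ∣ CC xs g) →
           Σ Comb λ ys → ∀ g → CC xs g ≡ CC ys g * n
  divide coprime n [] [] _ = [] , λ g → sym (ℤ.*-zeroˡ n)
  divide coprime n ((c , ρ@(i , t , e , _)) ∷ xs) (fresh ∷ normal) n∣ =
    (d , ρ) ∷ ys , λ g → begin
      c * R ρ g + CC xs g          ≡⟨ cong₂ (λ a b → a * R ρ g + b) c≡dn (ys-divides g) ⟩
      d * n * R ρ g + CC ys g * n  ≡⟨ factor d n (R ρ g) (CC ys g) ⟩
      (d * R ρ g + CC ys g) * n    ∎
    where
    factor : ∀ d n X Y → d * n * X + Y * n ≡ (d * X + Y) * n
    factor = solve-∀

    n∣cP : n ∣ c * pCoeff i t
    n∣cP = subst (n ∣_) (trans (CC-head c ρ xs (α i) fresh) (cong (c *_) (relElem-α i t e))) (n∣ (α i))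

    n∣cS : n ∣ c * qCoeff i t e
    n∣cS = subst (n ∣_) (trans (CC-head c ρ xs (β i) fresh) (cong (c *_) (relElem-β i t e))) (n∣ (β i))

    n∣c : n ∣ c
    n∣c = coprime-cofactor
            (subst (Coprime (p i ^ t)) (sym (∣signed∣ e (+ (q i ^ t)))) (coprime i t))
            n∣cP n∣cS

    d : ℤ
    d = _∣_.quotient n∣c

    c≡dn : c ≡ d * n
    c≡dn = _∣_.equality n∣c

    recursive : Σ Comb λ ys → ∀ g → CC xs g ≡ CC ys g * n
    recursive = divide coprime n xs normal λ g → ∣m+n∣m⇒∣n (n∣ g) (∣m⇒∣m*n (R ρ g) n∣c)

    ys : Comb
    ys = proj₁ recursive

    ys-divides : ∀ g → CC xs g ≡ CC ys g * n
    ys-divides = proj₂ recursive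

lemma3p3 : (p q r : ℕ → ℕ) → PrimePartition p q r →
    (ψ : StageFun) → QuotientTorsionFree p q ψ
lemma3p3 p q r part ψ n x n≢0 (xs , nx≡xs) = ys , λ g →
    ℤ.*-cancelʳ-≡ (coeff x g) (CC ys g) n {{ℤ.≢-nonZero n≢0}} (begin
      coeff x g * n         ≡⟨ ℤ.*-comm (coeff x g) n ⟩
      n * coeff x g         ≡⟨ sym (coeff-scale n x g) ⟩
      coeff (scale n x) g   ≡⟨ nx≡normal g ⟩
      CC (normalise xs) g   ≡⟨ normal≡ys g ⟩
      CC ys g * n           ∎)
  where
  open PrimePartition part
  open Combinations p q ψ

  coprime : ∀ i t → Coprime (p i ^ t) (q i ^ t)
  coprime i t = coprime-^ (distinct-primes-coprime (proj₁ (p-oddPrime i))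
                                                   (proj₁ (q-oddPrime i)) (p≢q i i)) t t

  nx≡normal : ∀ g → coeff (scale n x) g ≡ CC (normalise xs) g
  nx≡normal g = trans (nx≡xs g) (sym (CC-normalise xs g))

  n∣normal : ∀ g → n ∣ CC (normalise xs) g
  n∣normal g = divides (coeff x g)
    (trans (sym (nx≡normal g)) (trans (coeff-scale n x g) (ℤ.*-comm n (coeff x g))))

  divided : Σ Comb λ ys → ∀ g → CC (normalise xs) g ≡ CC ys g * n
  divided = divide coprime n (normalise xs) (normalise-normal xs) n∣normal

  ys : Comb
  ys = proj₁ divided

  normal≡ys : ∀ g → CC (normalise xs) g ≡ CC ys g * n
  normal≡ys = proj₂ divided
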